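{- Let $m,n,h,k$ be non-negative integers with $m\geq h>1$ and $n\geq k>1$. Non-decreasing sequences $A=[a_1,\dots,a_m]$ and $B=[b_1,\dots,b_n]$ of non-negative integers are the losing score lists of some $[h\text{ - }k]$-bipartite hypertournament (with $|U|=m$, $|V|=n$) if and only if for all integers $p,q$ with $1\le p\le m$ and $1\le q\le n$, $$\sum_{i=1}^{p}a_i+\sum_{j=1}^{q}b_j\;\geq\;\binom{p}{h}\binom{q}{k},$$ with equality when $p=m$ and $q=n$.
   Context: An $[h\text{ - }k]$-bipartite hypertournament on vertex sets $U$ and $V$ (disjoint, $|U|=m$, $|V|=n$, $m\ge h>1$, $n\ge k>1$) consists of $U$, $V$ and a set of arcs, each arc being an ordered $(h+k)$-tuple of distinct vertices with exactly $h$ entries from $U$ and exactly $k$ entries from $V$, such that for every $h$-subset $U_1\subseteq U$ and every $k$-subset $V_1\subseteq V$, the arc set contains exactly one of the $(h+k)!$ orderings of $U_1\cup V_1$. The losing score of a vertex $w$ is the number of arcs containing $w$ in which $w$ is the last entry. The losing score lists of the hypertournament are the pair of sequences obtained by listing the losing scores of the vertices of $U$, respectively of $V$, in non-decreasing order. Convention: $\binom{p}{q}=\frac{p!}{q!(p-q)!}$ if $p\ge q$ and $\binom{p}{q}=0$ if $p<q$. -}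

module Defs where

open import Data.Nat using (ℕ; zero; suc; _+_; _*_; _≤_)
open import Data.Bool using (true; false)
open import Data.Fin as Fin using (Fin)
open import Data.Fin.Subset using (Subset; ∣_∣) renaming (_∈_ to _∈ₛ_)
open import Data.Sum using (_⊎_; inj₁; inj₂)
open import Data.Sum.Properties using (≡-dec)
open import Data.Maybe using (Maybe; just)
open import Data.Vec as Vec using (Vec; []; _∷_; lookup)
open import Data.List as List using (List; length; last; filter; take; tabulate)
open import Data.Nat.ListAction using (sum)
open import Data.List.Relation.Unary.All using (All)
open import Data.List.Relation.Unary.Unique.Propositional using (Unique)
open import Data.List.Relation.Binary.Permutation.Propositional using (_↭_)
open import Data.Product using (Σ; _×_; ∃)
open import Relation.Binary.PropositionalEquality using (_≡_)
open import Relation.Nullary using (Dec; yes; no)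
open import Relation.Nullary.Decidable using (_×-dec_)
import Data.Fin.Properties as FinP
import Data.Nat.Properties as ℕP
import Data.Maybe.Properties as MaybeP

-- Vertices of a bipartite hypertournament with |U| = m, |V| = n:
-- inj₁ i is the i-th vertex of U, inj₂ j is the j-th vertex of V.
Vertex : ℕ → ℕ → Set
Vertex m n = Fin m ⊎ Fin n

_∈ᵤᵥ_ : ∀ {m n} → Vertex m n → Subset m × Subset n → Set
inj₁ i ∈ᵤᵥ (U₁ Data.Product., V₁) = i ∈ₛ U₁
inj₂ j ∈ᵤᵥ (U₁ Data.Product., V₁) = j ∈ₛ V₁

allSubsets : (m : ℕ) → List (Subset m)
allSubsets zero = [] List.∷ List.[]
allSubsets (suc m) =
  List.map (true ∷_) (allSubsets m) List.++ List.map (false ∷_) (allSubsets m)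

hkPairs : (m n h k : ℕ) → List (Subset m × Subset n)
hkPairs m n h k =
  filter (λ p → (∣ Data.Product.proj₁ p ∣ ℕP.≟ h) ×-dec (∣ Data.Product.proj₂ p ∣ ℕP.≟ k))
    (List.cartesianProduct (allSubsets m) (allSubsets n))

-- An [h-k]-bipartite hypertournament on U = Fin m, V = Fin n:
-- to every h-subset U₁ of U and k-subset V₁ of V it assigns exactly one arc,
-- an ordered (h+k)-tuple of distinct vertices whose entries are those of U₁ ∪ V₁
-- (i.e. an ordering of U₁ ∪ V₁). Values of `arc` on pairs of other sizes are irrelevant.
record BipartiteHypertournament (m n h k : ℕ) : Set where
  field
    arc       : Subset m → Subset n → List (Vertex m n)
    arc-len   : ∀ U₁ V₁ → ∣ U₁ ∣ ≡ h → ∣ V₁ ∣ ≡ k → length (arc U₁ V₁) ≡ h + k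
    arc-dist  : ∀ U₁ V₁ → ∣ U₁ ∣ ≡ h → ∣ V₁ ∣ ≡ k → Unique (arc U₁ V₁)
    arc-elems : ∀ U₁ V₁ → ∣ U₁ ∣ ≡ h → ∣ V₁ ∣ ≡ k →
                All (λ w → w ∈ᵤᵥ (U₁ Data.Product., V₁)) (arc U₁ V₁)

  losingScore : Vertex m n → ℕ
  losingScore w =
    length (filter (λ p → MaybeP.≡-dec (≡-dec FinP._≟_ FinP._≟_)
                            (last (arc (Data.Product.proj₁ p) (Data.Product.proj₂ p))) (just w))
                   (hkPairs m n h k))

NonDecreasing : ∀ {m} → Vec ℕ m → Set
NonDecreasing {m} A = ∀ (i j : Fin m) → i Fin.≤ j → lookup A i ≤ lookup A j

-- A and B (non-decreasing) are the losing score lists of T: A is the list of losing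
-- scores of the vertices of U up to rearrangement, likewise B for V.
-- (Since A, B are assumed non-decreasing, this says they are the sorted lists.)
AreLosingScoreLists : ∀ {m n h k} → BipartiteHypertournament m n h k →
                      Vec ℕ m → Vec ℕ n → Set
AreLosingScoreLists {m} {n} T A B =
  (tabulate (λ i → losingScore (inj₁ i)) ↭ Vec.toList A) ×
  (tabulate (λ j → losingScore (inj₂ j)) ↭ Vec.toList B)
  where open BipartiteHypertournament T

prefixSum : ∀ {m} → Vec ℕ m → ℕ → ℕ
prefixSum A p = sum (take p (Vec.toList A))

-- Choosing the last entry of every arc is all that matters: the other entries of the arc on
-- (U₁, V₁) can be listed in any order, and the losing score of w counts the pairs (U₁, V₁)
-- whose chosen vertex is w.  For a vertex set S = X ∪ Y (X ⊆ U, Y ⊆ V) the C(|X|,h)·C(|Y|,k)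
-- pairs inside S all choose a vertex of S, so the scores on S sum to at least that number;
-- with X and Y the p resp. q vertices of smallest score this gives the inequalities, and
-- every pair choosing exactly one vertex gives the equality.
--
-- Conversely, read the conditions as a Hall-type condition: with the given scores as
-- capacities, no vertex set contains more pairs than its capacity (sorted prefix sums are the
-- least sums over sets of a given size).  Pairs are then assigned one at a time.  The number
-- of pairs inside a set is supermodular and the capacity is modular, so the sets where
-- equality holds ("tight" sets) are closed under union.  A new pair cannot lie inside the
-- largest tight set, and it can be given to any of its vertices outside that set without
-- breaking the condition.  As the total capacity equals the number of pairs, every vertex ends
-- up with exactly its prescribed score.

module Submission where

open import Defs

open import Algebra.Bundles using (CommutativeMonoid)
open import Data.Bool using (Bool; true; false; _∧_; if_then_else_)
import Data.Bool.Properties as BoolP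
open import Data.Fin as Fin using (Fin; zero; suc)
import Data.Fin.Properties as FinP
open import Data.Fin.Subset using (Subset; ∣_∣; _∪_; _∩_; ⊥; ⊤; ⁅_⁆; _⊆_) renaming (_∈_ to _∈ₛ_)
open import Data.Fin.Subset.Properties
  using (_∈?_; _⊆?_; ⊆-trans; ⊆⊤; p⊆p∪q; q⊆p∪q; x∈p∩q⁺; ∈⊤; x∈⁅x⁆; ∣⊤∣≡n; ∣⊥∣≡0; ∣p∣≤n)
open import Data.List as List
  using (List; []; _∷_; _++_; [_]; length; filter; tabulate; last; cartesianProduct)
open import Data.List.Membership.Propositional using (_∈_)
open import Data.List.Membership.Propositional.Properties
  using (∈-map⁺; ∈-map⁻; ∈-++⁺ˡ; ∈-++⁺ʳ; ∈-++⁻; ∈-cartesianProduct⁺; ∈-filter⁺; ∈-filter⁻)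
open import Data.List.Properties
  using (tabulate-cong; take-all; length-tabulate; length-++; length-map;
         filter-all; filter-accept; filter-reject)
open import Data.List.Relation.Binary.Permutation.Propositional as ↭ using (_↭_)
open import Data.List.Relation.Unary.All as All using (All; []; _∷_)
import Data.List.Relation.Unary.All.Properties as AllP
open import Data.List.Relation.Unary.AllPairs using ([]; _∷_)
open import Data.List.Relation.Unary.Any using (here; there)
open import Data.List.Relation.Unary.Unique.Propositional using (Unique)
import Data.List.Relation.Unary.Unique.Propositional.Properties as UniqueP
open import Data.Maybe using (Maybe; just; nothing; maybe′)
import Data.Maybe.Properties as MaybeP
open import Data.Maybe.Relation.Unary.Any as MaybeAny using (just)
open import Data.Nat using (ℕ; zero; suc; _+_; _*_; _∸_; _≤_; _<_; _≥_; z≤n; s≤s)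
open import Data.Nat.Combinatorics using (_C_; nCk+nC[k+1]≡[n+1]C[k+1]; k>n⇒nCk≡0)
open import Data.Nat.ListAction using (sum)
open import Data.Nat.ListAction.Properties using (sum-↭)
open import Data.Nat.Properties
open import Data.Product as Product using (Σ; _×_; _,_; proj₁; proj₂; ∃)
import Data.Product.Properties as ProductP
open import Data.Sum using (inj₁; inj₂)
import Data.Sum.Properties as SumP
open import Data.Vec using (Vec; []; _∷_; here; there; lookup; toList; fromList)
import Data.Vec.Properties as VecP
open import Function using (_∘_; id)
open import Function.Bundles using (_⇔_; mk⇔)
open import Level using (Level)
open import Relation.Binary using (DecidableEquality) renaming (Decidable to Decidable₂)
open import Relation.Binary.PropositionalEquality
  using (_≡_; _≢_; refl; sym; trans; cong; cong₂; subst; _≗_; module ≡-Reasoning)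
open import Relation.Nullary using (Dec; yes; no; does; ¬_)
open import Relation.Nullary.Decidable using (_×-dec_; ¬?; dec-true; dec-false; decidable-stable)
open import Relation.Nullary.Negation using (contradiction)
open import Relation.Unary using (Pred; Decidable)

open import Algebra.Properties.CommutativeSemigroup +-commutativeSemigroup
  using (interchange; x∙yz≈y∙xz)
open import Algebra.Properties.CommutativeSemigroup
  (CommutativeMonoid.commutativeSemigroup BoolP.∧-commutativeMonoid)
  using () renaming (interchange to ∧-interchange)

private variable
  a : Level
  A B : Set a
  k m n : ℕ

𝟙 : Bool → ℕ
𝟙 true  = 1
𝟙 false = 0

count : (A → Bool) → List A → ℕ
count p []       = 0
count p (x ∷ xs) = 𝟙 (p x) + count p xs

length-filter≡count : ∀ {P : Pred A a} (P? : Decidable P) xs →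
                      length (filter P? xs) ≡ count (does ∘ P?) xs
length-filter≡count P? []       = refl
length-filter≡count P? (x ∷ xs) with does (P? x)
... | true  = cong suc (length-filter≡count P? xs)
... | false = length-filter≡count P? xs

count-cong : ∀ {p q : A → Bool} xs → (∀ {x} → x ∈ xs → p x ≡ q x) → count p xs ≡ count q xs
count-cong []       p≡q = refl
count-cong (x ∷ xs) p≡q = cong₂ _+_ (cong 𝟙 (p≡q (here refl))) (count-cong xs (p≡q ∘ there))

count≤length : ∀ (p : A → Bool) xs → count p xs ≤ length xs
count≤length p []       = z≤n
count≤length p (x ∷ xs) with p x
... | true  = s≤s (count≤length p xs)
... | false = m≤n⇒m≤1+n (count≤length p xs)

count-all : ∀ {P : Pred A a} (P? : Decidable P) xs → (∀ {x} → x ∈ xs → P x) →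
            count (does ∘ P?) xs ≡ length xs
count-all P? []       _  = refl
count-all P? (x ∷ xs) px rewrite dec-true (P? x) (px (here refl)) =
  cong suc (count-all P? xs (px ∘ there))

count-mono : ∀ {P Q : Pred A a} (P? : Decidable P) (Q? : Decidable Q) xs →
             (∀ {x} → x ∈ xs → P x → Q x) → count (does ∘ P?) xs ≤ count (does ∘ Q?) xs
count-mono P? Q? []       P⇒Q = z≤n
count-mono P? Q? (x ∷ xs) P⇒Q with P? x | Q? x | count-mono P? Q? xs (P⇒Q ∘ there)
... | yes _  | yes _   | rest = s≤s rest
... | yes px | no ¬qx  | _    = contradiction (P⇒Q (here refl) px) ¬qx
... | no _   | _       | rest = ≤-trans rest (m≤n+m _ _)

count-false : ∀ (xs : List A) → count (λ _ → false) xs ≡ 0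
count-false []       = refl
count-false (x ∷ xs) = count-false xs

count-++ : ∀ (p : A → Bool) xs ys → count p (xs ++ ys) ≡ count p xs + count p ys
count-++ p []       ys = refl
count-++ p (x ∷ xs) ys = trans (cong (𝟙 (p x) +_) (count-++ p xs ys)) (sym (+-assoc (𝟙 (p x)) _ _))

count-map : ∀ (p : B → Bool) (f : A → B) xs → count p (List.map f xs) ≡ count (p ∘ f) xs
count-map p f []       = refl
count-map p f (x ∷ xs) = cong (𝟙 (p (f x)) +_) (count-map p f xs)

count-filter : ∀ {P : Pred A a} (P? : Decidable P) (p : A → Bool) xs →
               count p (filter P? xs) ≡ count (λ x → does (P? x) ∧ p x) xs
count-filter P? p []       = refl
count-filter P? p (x ∷ xs) with does (P? x)
... | true  = cong (𝟙 (p x) +_) (count-filter P? p xs)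
... | false = count-filter P? p xs

count-cartesianProduct : ∀ (p : A → Bool) (q : B → Bool) xs ys →
  count (λ xy → p (proj₁ xy) ∧ q (proj₂ xy)) (cartesianProduct xs ys) ≡ count p xs * count q ys
count-cartesianProduct p q []       ys = refl
count-cartesianProduct p q (x ∷ xs) ys = begin
  count _ (List.map (x ,_) ys ++ cartesianProduct xs ys)
    ≡⟨ count-++ _ (List.map (x ,_) ys) _ ⟩
  count _ (List.map (x ,_) ys) + count _ (cartesianProduct xs ys)
    ≡⟨ cong₂ _+_ (trans (count-map _ (x ,_) ys) (row (p x))) (count-cartesianProduct p q xs ys) ⟩
  𝟙 (p x) * count q ys + count p xs * count q ys
    ≡⟨ *-distribʳ-+ (count q ys) (𝟙 (p x)) (count p xs) ⟨
  count p (x ∷ xs) * count q ys ∎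
  where
  open ≡-Reasoning
  row : ∀ b → count (λ y → b ∧ q y) ys ≡ 𝟙 b * count q ys
  row true  = sym (+-identityʳ _)
  row false = count-false ys

count-+-mono : ∀ {p q r s : A → Bool} xs →
               (∀ x → 𝟙 (p x) + 𝟙 (q x) ≤ 𝟙 (r x) + 𝟙 (s x)) →
               count p xs + count q xs ≤ count r xs + count s xs
count-+-mono []       pq≤rs = z≤n
count-+-mono {p = p} {q} {r} {s} (x ∷ xs) pq≤rs = begin
  (𝟙 (p x) + count p xs) + (𝟙 (q x) + count q xs) ≡⟨ interchange (𝟙 (p x)) _ _ _ ⟩
  (𝟙 (p x) + 𝟙 (q x)) + (count p xs + count q xs) ≤⟨ +-mono-≤ (pq≤rs x) (count-+-mono xs pq≤rs) ⟩
  (𝟙 (r x) + 𝟙 (s x)) + (count r xs + count s xs) ≡⟨ interchange (𝟙 (r x)) _ _ _ ⟩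
  (𝟙 (r x) + count r xs) + (𝟙 (s x) + count s xs) ∎
  where open ≤-Reasoning

last-∷ʳ : ∀ (xs : List A) x → last (xs ++ [ x ]) ≡ just x
last-∷ʳ []           x = refl
last-∷ʳ (y ∷ [])     x = refl
last-∷ʳ (y ∷ z ∷ xs) x = last-∷ʳ (z ∷ xs) x

All⇒Any-last : ∀ {P : Pred A a} {x xs} → All P (x ∷ xs) → MaybeAny.Any P (last (x ∷ xs))
All⇒Any-last (px ∷ [])          = just px
All⇒Any-last (_ ∷ pys@(_ ∷ _)) = All⇒Any-last pys

length-filter-≢ : ∀ (_≟_ : DecidableEquality A) {x xs} → Unique xs → x ∈ xs →
                  suc (length (filter (λ y → ¬? (y ≟ x)) xs)) ≡ length xs
length-filter-≢ _≟_ {xs = x ∷ xs} (x≢xs ∷ _) (here refl) =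
  cong (suc ∘ length) (trans (filter-reject (λ y → ¬? (y ≟ x)) (λ x≢x → x≢x refl))
                             (filter-all (λ y → ¬? (y ≟ x)) (All.map (_∘ sym) x≢xs)))
length-filter-≢ _≟_ {x} {y ∷ xs} (y≢xs ∷ unique) (there x∈xs) =
  trans (cong (suc ∘ length) (filter-accept (λ z → ¬? (z ≟ x)) (All.lookup y≢xs x∈xs)))
        (cong suc (length-filter-≢ _≟_ unique x∈xs))

sumOver : Subset k → (Fin k → ℕ) → ℕ
sumOver []          f = 0
sumOver (true  ∷ X) f = f zero + sumOver X (f ∘ suc)
sumOver (false ∷ X) f = sumOver X (f ∘ suc)

sumOver-cong : ∀ (X : Subset k) {f g} → f ≗ g → sumOver X f ≡ sumOver X g
sumOver-cong []          f≗g = refl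
sumOver-cong (true  ∷ X) f≗g = cong₂ _+_ (f≗g zero) (sumOver-cong X (f≗g ∘ suc))
sumOver-cong (false ∷ X) f≗g = sumOver-cong X (f≗g ∘ suc)

sumOver-mono : ∀ (X : Subset k) {f g} → (∀ i → f i ≤ g i) → sumOver X f ≤ sumOver X g
sumOver-mono []          f≤g = z≤n
sumOver-mono (true  ∷ X) f≤g = +-mono-≤ (f≤g zero) (sumOver-mono X (f≤g ∘ suc))
sumOver-mono (false ∷ X) f≤g = sumOver-mono X (f≤g ∘ suc)

sumOver-0 : ∀ (X : Subset k) → sumOver X (λ _ → 0) ≡ 0
sumOver-0 []          = refl
sumOver-0 (true  ∷ X) = sumOver-0 X
sumOver-0 (false ∷ X) = sumOver-0 X

sumOver-⊥ : ∀ (f : Fin k → ℕ) → sumOver ⊥ f ≡ 0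
sumOver-⊥ {zero}  f = refl
sumOver-⊥ {suc k} f = sumOver-⊥ (f ∘ suc)

sumOver-⁅⁆ : ∀ (i : Fin k) f → sumOver ⁅ i ⁆ f ≡ f i
sumOver-⁅⁆ zero    f = trans (cong (f zero +_) (sumOver-⊥ (f ∘ suc))) (+-identityʳ _)
sumOver-⁅⁆ (suc i) f = sumOver-⁅⁆ i (f ∘ suc)

sumOver-+ : ∀ (X : Subset k) f g → sumOver X (λ i → f i + g i) ≡ sumOver X f + sumOver X g
sumOver-+ []          f g = refl
sumOver-+ (true  ∷ X) f g = trans (cong (f zero + g zero +_) (sumOver-+ X (f ∘ suc) (g ∘ suc)))
                                  (interchange (f zero) (g zero) _ _)
sumOver-+ (false ∷ X) f g = sumOver-+ X (f ∘ suc) (g ∘ suc)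

sumOver-∪-∩ : ∀ (X Y : Subset k) f → sumOver (X ∪ Y) f + sumOver (X ∩ Y) f ≡ sumOver X f + sumOver Y f
sumOver-∪-∩ []          []          f = refl
sumOver-∪-∩ (true  ∷ X) (true  ∷ Y) f = begin
  (f zero + sumOver (X ∪ Y) _) + (f zero + sumOver (X ∩ Y) _) ≡⟨ interchange (f zero) _ _ _ ⟩
  (f zero + f zero) + (sumOver (X ∪ Y) _ + sumOver (X ∩ Y) _) ≡⟨ cong (f zero + f zero +_) (sumOver-∪-∩ X Y _) ⟩
  (f zero + f zero) + (sumOver X _ + sumOver Y _)             ≡⟨ interchange (f zero) _ _ _ ⟩
  (f zero + sumOver X _) + (f zero + sumOver Y _)             ∎
  where open ≡-Reasoning
sumOver-∪-∩ (true  ∷ X) (false ∷ Y) f =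
  trans (+-assoc (f zero) _ _)
        (trans (cong (f zero +_) (sumOver-∪-∩ X Y (f ∘ suc))) (sym (+-assoc (f zero) _ _)))
sumOver-∪-∩ (false ∷ X) (true  ∷ Y) f = begin
  (f zero + sumOver (X ∪ Y) _) + sumOver (X ∩ Y) _ ≡⟨ +-assoc (f zero) _ _ ⟩
  f zero + (sumOver (X ∪ Y) _ + sumOver (X ∩ Y) _) ≡⟨ cong (f zero +_) (sumOver-∪-∩ X Y (f ∘ suc)) ⟩
  f zero + (sumOver X _ + sumOver Y _)             ≡⟨ x∙yz≈y∙xz (f zero) (sumOver X _) _ ⟩
  sumOver X _ + (f zero + sumOver Y _)             ∎
  where open ≡-Reasoning
sumOver-∪-∩ (false ∷ X) (false ∷ Y) f = sumOver-∪-∩ X Y (f ∘ suc)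

sumOver-≟ : ∀ (X : Subset k) i → sumOver X (λ j → 𝟙 (does (i Fin.≟ j))) ≡ 𝟙 (does (i ∈? X))
sumOver-≟ (true  ∷ X) zero    = cong suc (sumOver-0 X)
sumOver-≟ (false ∷ X) zero    = sumOver-0 X
sumOver-≟ (true  ∷ X) (suc i) = sumOver-≟ X i
sumOver-≟ (false ∷ X) (suc i) = sumOver-≟ X i

sumOver-⊤ : ∀ (f : Fin k → ℕ) → sumOver ⊤ f ≡ sum (tabulate f)
sumOver-⊤ {zero}  f = refl
sumOver-⊤ {suc k} f = cong (f zero +_) (sumOver-⊤ (f ∘ suc))

+-≤-≡-split : ∀ {a b c d} → a ≤ c → b ≤ d → a + b ≡ c + d → a ≡ c × b ≡ d
+-≤-≡-split {a} {b} {c} {d} a≤c b≤d eq =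
  ≤-antisym a≤c (+-cancelʳ-≤ b c a (≤-trans (+-monoʳ-≤ c b≤d) (≤-reflexive (sym eq)))) ,
  ≤-antisym b≤d (+-cancelˡ-≤ a d b (≤-trans (+-monoˡ-≤ d a≤c) (≤-reflexive (sym eq))))

sumOver-⊤-≗ : ∀ {f g : Fin k → ℕ} → (∀ i → f i ≤ g i) → sumOver ⊤ f ≡ sumOver ⊤ g → f ≗ g
sumOver-⊤-≗ f≤g eq zero    = proj₁ (+-≤-≡-split (f≤g zero) (sumOver-mono ⊤ (f≤g ∘ suc)) eq)
sumOver-⊤-≗ f≤g eq (suc i) = sumOver-⊤-≗ (f≤g ∘ suc)
  (proj₂ (+-≤-≡-split (f≤g zero) (sumOver-mono ⊤ (f≤g ∘ suc)) eq)) i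

⊈⇒∃∉ : ∀ {X Y : Subset k} → ¬ X ⊆ Y → ∃ λ i → i ∈ₛ X × ¬ i ∈ₛ Y
⊈⇒∃∉ {X = X} {Y} X⊈Y with FinP.any? (λ i → i ∈? X ×-dec ¬? (i ∈? Y))
... | yes witness = witness
... | no  none    =
  contradiction (λ {i} i∈X → decidable-stable (i ∈? Y) (λ i∉Y → none (i , i∈X , i∉Y))) X⊈Y

members : Subset k → List (Fin k)
members []          = []
members (true  ∷ X) = zero ∷ List.map suc (members X)
members (false ∷ X) = List.map suc (members X)

length-members : ∀ (X : Subset k) → length (members X) ≡ ∣ X ∣
length-members []          = refl
length-members (true  ∷ X) = cong suc (trans (length-map suc (members X)) (length-members X))
length-members (false ∷ X) = trans (length-map suc (members X)) (length-members X)

∈-members⁺ : ∀ {X : Subset k} {i} → i ∈ₛ X → i ∈ members X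
∈-members⁺ {X = true  ∷ X} here        = here refl
∈-members⁺ {X = true  ∷ X} (there i∈X) = there (∈-map⁺ suc (∈-members⁺ i∈X))
∈-members⁺ {X = false ∷ X} (there i∈X) = ∈-map⁺ suc (∈-members⁺ i∈X)

∈-members⁻ : ∀ {X : Subset k} {i} → i ∈ members X → i ∈ₛ X
∈-members⁻ {X = true  ∷ X} (here refl) = here
∈-members⁻ {X = true  ∷ X} (there i∈) with ∈-map⁻ suc i∈
... | _ , j∈ , refl = there (∈-members⁻ j∈)
∈-members⁻ {X = false ∷ X} i∈ with ∈-map⁻ suc i∈
... | _ , j∈ , refl = there (∈-members⁻ j∈)

members-unique : ∀ (X : Subset k) → Unique (members X)
members-unique []          = []
members-unique (true  ∷ X) = AllP.map⁺ (All.universal (λ _ ()) (members X)) ∷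
                             UniqueP.map⁺ FinP.suc-injective (members-unique X)
members-unique (false ∷ X) = UniqueP.map⁺ FinP.suc-injective (members-unique X)

∈-allSubsets : ∀ (X : Subset k) → X ∈ allSubsets k
∈-allSubsets []          = here refl
∈-allSubsets (true  ∷ X) = ∈-++⁺ˡ (∈-map⁺ (true ∷_) (∈-allSubsets X))
∈-allSubsets (false ∷ X) =
  ∈-++⁺ʳ (List.map (true ∷_) (allSubsets _)) (∈-map⁺ (false ∷_) (∈-allSubsets X))

allSubsets-unique : ∀ k → Unique (allSubsets k)
allSubsets-unique zero    = [] ∷ []
allSubsets-unique (suc k) = UniqueP.++⁺ (UniqueP.map⁺ VecP.∷-injectiveʳ (allSubsets-unique k))
                                        (UniqueP.map⁺ VecP.∷-injectiveʳ (allSubsets-unique k))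
                                        disjoint
  where
  disjoint : ∀ {X} → ¬ (X ∈ List.map (true ∷_) (allSubsets k) × X ∈ List.map (false ∷_) (allSubsets k))
  disjoint (p , q) with ∈-map⁻ (true ∷_) p | ∈-map⁻ (false ∷_) q
  ... | _ , _ , refl | _ , _ , ()

count-⊆-allSubsets : ∀ (X : Subset k) h →
                     count (λ U → does (∣ U ∣ ≟ h) ∧ does (U ⊆? X)) (allSubsets k) ≡ ∣ X ∣ C h
count-⊆-allSubsets []      zero    = refl
count-⊆-allSubsets []      (suc h) = refl
count-⊆-allSubsets {suc k} (x ∷ X) h = begin
  count sized⊆ (List.map (true ∷_) subsets ++ List.map (false ∷_) subsets)
    ≡⟨ count-++ sized⊆ (List.map (true ∷_) subsets) _ ⟩
  count sized⊆ (List.map (true ∷_) subsets) + count sized⊆ (List.map (false ∷_) subsets)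
    ≡⟨ cong₂ _+_ (count-map sized⊆ (true ∷_) subsets)
                 (trans (count-map sized⊆ (false ∷_) subsets) (count-⊆-allSubsets X h)) ⟩
  count (sized⊆ ∘ (true ∷_)) subsets + ∣ X ∣ C h
    ≡⟨ pascal x h ⟩
  ∣ x ∷ X ∣ C h ∎
  where
  open ≡-Reasoning
  subsets = allSubsets k
  sized⊆ : Subset (suc k) → Bool
  sized⊆ U = does (∣ U ∣ ≟ h) ∧ does (U ⊆? x ∷ X)
  pascal : ∀ x h → count (λ U → does (suc ∣ U ∣ ≟ h) ∧ does (true ∷ U ⊆? x ∷ X)) subsets + ∣ X ∣ C h
                   ≡ ∣ x ∷ X ∣ C h
  pascal true  zero    = cong (_+ 1) (count-false subsets)
  pascal true  (suc h) = trans (cong (_+ ∣ X ∣ C suc h) (count-⊆-allSubsets X h))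
                               (nCk+nC[k+1]≡[n+1]C[k+1] ∣ X ∣ h)
  pascal false h       = cong (_+ ∣ X ∣ C h)
    (trans (count-cong subsets (λ _ → BoolP.∧-zeroʳ _)) (count-false subsets))

VertexSet : ℕ → ℕ → Set
VertexSet m n = Subset m × Subset n

_≟ᵥ_ : DecidableEquality (Vertex m n)
_≟ᵥ_ = SumP.≡-dec Fin._≟_ Fin._≟_

_∈ᵥ?_ : ∀ (v : Vertex m n) S → Dec (v ∈ᵤᵥ S)
inj₁ i ∈ᵥ? (X , Y) = i ∈? X
inj₂ j ∈ᵥ? (X , Y) = j ∈? Y

infix 4 _⊆ᵥ_ _⊆ᵥ?_ _∈ᵥ?_
infixr 6 _∪ᵥ_ _∩ᵥ_

_⊆ᵥ_ : VertexSet m n → VertexSet m n → Set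
(U , V) ⊆ᵥ (X , Y) = U ⊆ X × V ⊆ Y

_⊆ᵥ?_ : Decidable₂ (_⊆ᵥ_ {m} {n})
(U , V) ⊆ᵥ? (X , Y) = U ⊆? X ×-dec V ⊆? Y

_∪ᵥ_ : VertexSet m n → VertexSet m n → VertexSet m n
(X , Y) ∪ᵥ (X′ , Y′) = X ∪ X′ , Y ∪ Y′

_∩ᵥ_ : VertexSet m n → VertexSet m n → VertexSet m n
(X , Y) ∩ᵥ (X′ , Y′) = X ∩ X′ , Y ∩ Y′

∅ᵥ ⊤ᵥ : VertexSet m n
∅ᵥ = ⊥ , ⊥
⊤ᵥ = ⊤ , ⊤

⁅_⁆ᵥ : Vertex m n → VertexSet m n
⁅ inj₁ i ⁆ᵥ = ⁅ i ⁆ , ⊥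
⁅ inj₂ j ⁆ᵥ = ⊥ , ⁅ j ⁆

⊆ᵥ-trans : ∀ {R S T : VertexSet m n} → R ⊆ᵥ S → S ⊆ᵥ T → R ⊆ᵥ T
⊆ᵥ-trans (U⊆X , V⊆Y) (X⊆X′ , Y⊆Y′) = ⊆-trans U⊆X X⊆X′ , ⊆-trans V⊆Y Y⊆Y′

⊆ᵥ-∪ˡ : ∀ (S T : VertexSet m n) → S ⊆ᵥ S ∪ᵥ T
⊆ᵥ-∪ˡ S (X′ , Y′) = p⊆p∪q X′ , p⊆p∪q Y′

⊆ᵥ-∪ʳ : ∀ (S T : VertexSet m n) → T ⊆ᵥ S ∪ᵥ T
⊆ᵥ-∪ʳ (X , Y) T = q⊆p∪q X _ , q⊆p∪q Y _

⊆ᵥ-∩ : ∀ {R S T : VertexSet m n} → R ⊆ᵥ S → R ⊆ᵥ T → R ⊆ᵥ S ∩ᵥ T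
⊆ᵥ-∩ (U⊆X , V⊆Y) (U⊆X′ , V⊆Y′) = (λ i∈U → x∈p∩q⁺ (U⊆X i∈U , U⊆X′ i∈U)) ,
                                  (λ j∈V → x∈p∩q⁺ (V⊆Y j∈V , V⊆Y′ j∈V))

∈-⊆ᵥ : ∀ {v : Vertex m n} {S T} → S ⊆ᵥ T → v ∈ᵤᵥ S → v ∈ᵤᵥ T
∈-⊆ᵥ {v = inj₁ i} (X⊆X′ , _) i∈X = X⊆X′ i∈X
∈-⊆ᵥ {v = inj₂ j} (_ , Y⊆Y′) j∈Y = Y⊆Y′ j∈Y

∈⊤ᵥ : ∀ (v : Vertex m n) → v ∈ᵤᵥ ⊤ᵥ
∈⊤ᵥ (inj₁ i) = ∈⊤
∈⊤ᵥ (inj₂ j) = ∈⊤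

∈⁅⁆ᵥ : ∀ (v : Vertex m n) → v ∈ᵤᵥ ⁅ v ⁆ᵥ
∈⁅⁆ᵥ (inj₁ i) = x∈⁅x⁆ i
∈⁅⁆ᵥ (inj₂ j) = x∈⁅x⁆ j

⊈ᵥ⇒∃∉ : ∀ {S T : VertexSet m n} → ¬ S ⊆ᵥ T → ∃ λ v → v ∈ᵤᵥ S × ¬ v ∈ᵤᵥ T
⊈ᵥ⇒∃∉ {S = U , V} {X , Y} S⊈T with U ⊆? X | V ⊆? Y
... | no  U⊈X | _         = Product.map inj₁ id (⊈⇒∃∉ U⊈X)
... | yes _   | no  V⊈Y   = Product.map inj₂ id (⊈⇒∃∉ V⊈Y)
... | yes U⊆X | yes V⊆Y   = contradiction ((λ {i} → U⊆X {i}) , (λ {j} → V⊆Y {j})) S⊈T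

sumOverᵥ : VertexSet m n → (Vertex m n → ℕ) → ℕ
sumOverᵥ (X , Y) c = sumOver X (c ∘ inj₁) + sumOver Y (c ∘ inj₂)

sumOverᵥ-cong : ∀ (S : VertexSet m n) {c d} → c ≗ d → sumOverᵥ S c ≡ sumOverᵥ S d
sumOverᵥ-cong (X , Y) c≗d = cong₂ _+_ (sumOver-cong X (c≗d ∘ inj₁)) (sumOver-cong Y (c≗d ∘ inj₂))

sumOverᵥ-0 : ∀ (S : VertexSet m n) → sumOverᵥ S (λ _ → 0) ≡ 0
sumOverᵥ-0 (X , Y) = cong₂ _+_ (sumOver-0 X) (sumOver-0 Y)

sumOverᵥ-∅ : ∀ (c : Vertex m n → ℕ) → sumOverᵥ ∅ᵥ c ≡ 0
sumOverᵥ-∅ c = cong₂ _+_ (sumOver-⊥ (c ∘ inj₁)) (sumOver-⊥ (c ∘ inj₂))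

sumOverᵥ-⁅⁆ : ∀ (v : Vertex m n) c → sumOverᵥ ⁅ v ⁆ᵥ c ≡ c v
sumOverᵥ-⁅⁆ (inj₁ i) c =
  trans (cong₂ _+_ (sumOver-⁅⁆ i (c ∘ inj₁)) (sumOver-⊥ (c ∘ inj₂))) (+-identityʳ _)
sumOverᵥ-⁅⁆ (inj₂ j) c = cong₂ _+_ (sumOver-⊥ (c ∘ inj₁)) (sumOver-⁅⁆ j (c ∘ inj₂))

sumOverᵥ-+ : ∀ (S : VertexSet m n) c d → sumOverᵥ S (λ v → c v + d v) ≡ sumOverᵥ S c + sumOverᵥ S d
sumOverᵥ-+ (X , Y) c d =
  trans (cong₂ _+_ (sumOver-+ X (c ∘ inj₁) (d ∘ inj₁)) (sumOver-+ Y (c ∘ inj₂) (d ∘ inj₂)))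
        (interchange (sumOver X (c ∘ inj₁)) _ _ _)

sumOverᵥ-∪-∩ : ∀ (S T : VertexSet m n) c →
               sumOverᵥ (S ∪ᵥ T) c + sumOverᵥ (S ∩ᵥ T) c ≡ sumOverᵥ S c + sumOverᵥ T c
sumOverᵥ-∪-∩ (X , Y) (X′ , Y′) c = begin
  (sumOver (X ∪ X′) _ + sumOver (Y ∪ Y′) _) + (sumOver (X ∩ X′) _ + sumOver (Y ∩ Y′) _)
    ≡⟨ interchange (sumOver (X ∪ X′) _) _ _ _ ⟩
  (sumOver (X ∪ X′) _ + sumOver (X ∩ X′) _) + (sumOver (Y ∪ Y′) _ + sumOver (Y ∩ Y′) _)
    ≡⟨ cong₂ _+_ (sumOver-∪-∩ X X′ (c ∘ inj₁)) (sumOver-∪-∩ Y Y′ (c ∘ inj₂)) ⟩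
  (sumOver X _ + sumOver X′ _) + (sumOver Y _ + sumOver Y′ _)
    ≡⟨ interchange (sumOver X _) _ _ _ ⟩
  (sumOver X _ + sumOver Y _) + (sumOver X′ _ + sumOver Y′ _) ∎
  where open ≡-Reasoning

sumOverᵥ-≟ : ∀ (S : VertexSet m n) v → sumOverᵥ S (λ w → 𝟙 (does (v ≟ᵥ w))) ≡ 𝟙 (does (v ∈ᵥ? S))
sumOverᵥ-≟ (X , Y) (inj₁ i) = trans (cong₂ _+_ (sumOver-≟ X i) (sumOver-0 Y)) (+-identityʳ _)
sumOverᵥ-≟ (X , Y) (inj₂ j) = cong₂ _+_ (sumOver-0 X) (sumOver-≟ Y j)

sumOverᵥ-⊤-≗ : ∀ {c d : Vertex m n → ℕ} → (∀ v → c v ≤ d v) →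
               sumOverᵥ ⊤ᵥ c ≡ sumOverᵥ ⊤ᵥ d → c ≗ d
sumOverᵥ-⊤-≗ c≤d eq = λ { (inj₁ i) → sumOver-⊤-≗ (c≤d ∘ inj₁) (proj₁ split) i
                         ; (inj₂ j) → sumOver-⊤-≗ (c≤d ∘ inj₂) (proj₂ split) j }
  where split = +-≤-≡-split (sumOver-mono ⊤ (c≤d ∘ inj₁)) (sumOver-mono ⊤ (c≤d ∘ inj₂)) eq

vertices : VertexSet m n → List (Vertex m n)
vertices (U , V) = List.map inj₁ (members U) ++ List.map inj₂ (members V)

length-vertices : ∀ (S : VertexSet m n) → length (vertices S) ≡ ∣ proj₁ S ∣ + ∣ proj₂ S ∣
length-vertices (U , V) = trans (length-++ (List.map inj₁ (members U)))
  (cong₂ _+_ (trans (length-map inj₁ (members U)) (length-members U))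
             (trans (length-map inj₂ (members V)) (length-members V)))

∈-vertices⁺ : ∀ {S : VertexSet m n} {v} → v ∈ᵤᵥ S → v ∈ vertices S
∈-vertices⁺ {v = inj₁ i} i∈U = ∈-++⁺ˡ (∈-map⁺ inj₁ (∈-members⁺ i∈U))
∈-vertices⁺ {S = U , V} {inj₂ j} j∈V =
  ∈-++⁺ʳ (List.map inj₁ (members U)) (∈-map⁺ inj₂ (∈-members⁺ j∈V))

∈-vertices⁻ : ∀ {S : VertexSet m n} {v} → v ∈ vertices S → v ∈ᵤᵥ S
∈-vertices⁻ {S = U , V} v∈ with ∈-++⁻ (List.map inj₁ (members U)) v∈
... | inj₁ v∈U with ∈-map⁻ inj₁ v∈U
...   | _ , i∈ , refl = ∈-members⁻ i∈
∈-vertices⁻ {S = U , V} v∈ | inj₂ v∈V with ∈-map⁻ inj₂ v∈V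
...   | _ , j∈ , refl = ∈-members⁻ j∈

vertices-unique : ∀ (S : VertexSet m n) → Unique (vertices S)
vertices-unique (U , V) = UniqueP.++⁺ (UniqueP.map⁺ SumP.inj₁-injective (members-unique U))
                                      (UniqueP.map⁺ SumP.inj₂-injective (members-unique V)) disjoint
  where
  disjoint : ∀ {v} → ¬ (v ∈ List.map inj₁ (members U) × v ∈ List.map inj₂ (members V))
  disjoint (v∈U , v∈V) with ∈-map⁻ inj₁ v∈U | ∈-map⁻ inj₂ v∈V
  ... | _ , _ , refl | _ , _ , ()

allVertexSets : List (VertexSet m n)
allVertexSets {m} {n} = cartesianProduct (allSubsets m) (allSubsets n)

∈-allVertexSets : ∀ (S : VertexSet m n) → S ∈ allVertexSets
∈-allVertexSets (X , Y) = ∈-cartesianProduct⁺ (∈-allSubsets X) (∈-allSubsets Y)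

⋃ᵥ : List (VertexSet m n) → VertexSet m n
⋃ᵥ = List.foldr _∪ᵥ_ ∅ᵥ

⊆-⋃ᵥ : ∀ {S : VertexSet m n} {Ss} → S ∈ Ss → S ⊆ᵥ ⋃ᵥ Ss
⊆-⋃ᵥ {Ss = S ∷ Ss} (here refl)  = ⊆ᵥ-∪ˡ S (⋃ᵥ Ss)
⊆-⋃ᵥ {Ss = T ∷ Ss} (there S∈Ss) = ⊆ᵥ-trans (⊆-⋃ᵥ S∈Ss) (⊆ᵥ-∪ʳ T (⋃ᵥ Ss))

-- Orientations with bounded indegrees

inside : List (VertexSet m n) → VertexSet m n → ℕ
inside es S = count (λ e → does (e ⊆ᵥ? S)) es

𝟙-supermodular : ∀ {p q r s} {P : Set p} {Q : Set q} {R : Set r} {S : Set s}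
                 (P? : Dec P) (Q? : Dec Q) (R? : Dec R) (S? : Dec S) →
                 (P → R) → (Q → R) → (P → Q → S) →
                 𝟙 (does P?) + 𝟙 (does Q?) ≤ 𝟙 (does R?) + 𝟙 (does S?)
𝟙-supermodular P? Q? R? S? P⇒R Q⇒R P∧Q⇒S with P? | Q?
... | yes p | yes q rewrite dec-true R? (P⇒R p) | dec-true S? (P∧Q⇒S p q) = ≤-refl
... | yes p | no _  rewrite dec-true R? (P⇒R p) = s≤s z≤n
... | no _  | yes q rewrite dec-true R? (Q⇒R q) = s≤s z≤n
... | no _  | no _  = z≤n

inside-supermodular : ∀ (es : List (VertexSet m n)) S T →
                      inside es S + inside es T ≤ inside es (S ∪ᵥ T) + inside es (S ∩ᵥ T)
inside-supermodular es S T = count-+-mono es λ e →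
  𝟙-supermodular (e ⊆ᵥ? S) (e ⊆ᵥ? T) (e ⊆ᵥ? S ∪ᵥ T) (e ⊆ᵥ? S ∩ᵥ T)
    (λ e⊆S → ⊆ᵥ-trans e⊆S (⊆ᵥ-∪ˡ S T)) (λ e⊆T → ⊆ᵥ-trans e⊆T (⊆ᵥ-∪ʳ S T)) ⊆ᵥ-∩

indegree : (A → Maybe (Vertex m n)) → List A → Vertex m n → ℕ
indegree g es w = count (λ e → does (MaybeP.≡-dec _≟ᵥ_ (g e) (just w))) es

sumOverᵥ-indegree : ∀ (S : VertexSet m n) (g : A → Maybe (Vertex m n)) es →
                    sumOverᵥ S (indegree g es) ≡ count (λ e → does (MaybeAny.dec (_∈ᵥ? S) (g e))) es
sumOverᵥ-indegree S g []       = sumOverᵥ-0 S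
sumOverᵥ-indegree S g (e ∷ es) =
  trans (sumOverᵥ-+ S (hits (g e)) (indegree g es))
        (cong₂ _+_ (sumOverᵥ-hits (g e)) (sumOverᵥ-indegree S g es))
  where
  hits : Maybe (Vertex m n) → Vertex m n → ℕ
  hits mv w = 𝟙 (does (MaybeP.≡-dec _≟ᵥ_ mv (just w)))
  sumOverᵥ-hits : ∀ mv → sumOverᵥ S (hits mv) ≡ 𝟙 (does (MaybeAny.dec (_∈ᵥ? S) mv))
  sumOverᵥ-hits nothing  = sumOverᵥ-0 S
  sumOverᵥ-hits (just v) = sumOverᵥ-≟ S v

Hall : List (VertexSet m n) → (Vertex m n → ℕ) → Set
Hall es c = ∀ S → inside es S ≤ sumOverᵥ S c

Hall-∷⁻ : ∀ (e : VertexSet m n) es c → Hall (e ∷ es) c → Hall es c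
Hall-∷⁻ e es c hall S = ≤-trans (m≤n+m _ _) (hall S)

Tight : List (VertexSet m n) → (Vertex m n → ℕ) → VertexSet m n → Set
Tight es c S = inside es S ≡ sumOverᵥ S c

module _ {m n : ℕ} (es : List (VertexSet m n)) (c : Vertex m n → ℕ) where

  maxTight : VertexSet m n
  maxTight = ⋃ᵥ (filter (λ S → inside es S ≟ sumOverᵥ S c) allVertexSets)

  tight⇒⊆maxTight : ∀ {S} → Tight es c S → S ⊆ᵥ maxTight
  tight⇒⊆maxTight {S} tS = ⊆-⋃ᵥ (∈-filter⁺ _ (∈-allVertexSets S) tS)

  module _ (hall : Hall es c) where

    tight-∅ : Tight es c ∅ᵥ
    tight-∅ = ≤-antisym (hall ∅ᵥ) (≤-trans (≤-reflexive (sumOverᵥ-∅ c)) z≤n)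

    tight-∪ : ∀ {S T} → Tight es c S → Tight es c T → Tight es c (S ∪ᵥ T)
    tight-∪ {S} {T} tS tT =
      ≤-antisym (hall (S ∪ᵥ T)) (+-cancelʳ-≤ (sumOverᵥ (S ∩ᵥ T) c) _ _ (begin
        sumOverᵥ (S ∪ᵥ T) c + sumOverᵥ (S ∩ᵥ T) c ≡⟨ sumOverᵥ-∪-∩ S T c ⟩
        sumOverᵥ S c + sumOverᵥ T c                ≡⟨ cong₂ _+_ tS tT ⟨
        inside es S + inside es T                  ≤⟨ inside-supermodular es S T ⟩
        inside es (S ∪ᵥ T) + inside es (S ∩ᵥ T)    ≤⟨ +-monoʳ-≤ _ (hall (S ∩ᵥ T)) ⟩
        inside es (S ∪ᵥ T) + sumOverᵥ (S ∩ᵥ T) c   ∎))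
      where open ≤-Reasoning

    ⋃ᵥ-tight : ∀ {Ss} → All (Tight es c) Ss → Tight es c (⋃ᵥ Ss)
    ⋃ᵥ-tight []       = tight-∅
    ⋃ᵥ-tight (t ∷ ts) = tight-∪ t (⋃ᵥ-tight ts)

    maxTight-tight : Tight es c maxTight
    maxTight-tight = ⋃ᵥ-tight (AllP.all-filter _ allVertexSets)

    ⊈maxTight : ∀ e → Hall (e ∷ es) c → ¬ e ⊆ᵥ maxTight
    ⊈maxTight e hall′ e⊆T = <-irrefl maxTight-tight
      (subst (λ b → 𝟙 b + inside es maxTight ≤ sumOverᵥ maxTight c)
             (dec-true (e ⊆ᵥ? maxTight) e⊆T) (hall′ maxTight))

lower : (Vertex m n → ℕ) → Vertex m n → Vertex m n → ℕ
lower c v w = c w ∸ 𝟙 (does (v ≟ᵥ w))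

lower-+ : ∀ (c : Vertex m n → ℕ) v → 1 ≤ c v → ∀ w → lower c v w + 𝟙 (does (v ≟ᵥ w)) ≡ c w
lower-+ c v c≥1 w with v ≟ᵥ w
... | yes refl = m∸n+n≡m c≥1
... | no  _    = +-identityʳ (c w)

sumOverᵥ-lower : ∀ (c : Vertex m n → ℕ) v → 1 ≤ c v → ∀ S →
                 sumOverᵥ S (lower c v) + 𝟙 (does (v ∈ᵥ? S)) ≡ sumOverᵥ S c
sumOverᵥ-lower c v c≥1 S = begin
  sumOverᵥ S (lower c v) + 𝟙 (does (v ∈ᵥ? S))
    ≡⟨ cong (sumOverᵥ S (lower c v) +_) (sumOverᵥ-≟ S v) ⟨
  sumOverᵥ S (lower c v) + sumOverᵥ S (λ w → 𝟙 (does (v ≟ᵥ w)))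
    ≡⟨ sumOverᵥ-+ S (lower c v) (λ w → 𝟙 (does (v ≟ᵥ w))) ⟨
  sumOverᵥ S (λ w → lower c v w + 𝟙 (does (v ≟ᵥ w)))
    ≡⟨ sumOverᵥ-cong S (lower-+ c v c≥1) ⟩
  sumOverᵥ S c ∎
  where open ≡-Reasoning

module _ {m n : ℕ} (es : List (VertexSet m n)) (c : Vertex m n → ℕ) (hall : Hall es c)
         {v : Vertex m n} (v∉T : ¬ v ∈ᵤᵥ maxTight es c) where

  private
    tight⇒∌v : ∀ {S} → Tight es c S → ¬ v ∈ᵤᵥ S
    tight⇒∌v tS v∈S = v∉T (∈-⊆ᵥ (tight⇒⊆maxTight es c tS) v∈S)

  outside-maxTight⇒positive : 1 ≤ c v
  outside-maxTight⇒positive = ≤-trans (s≤s z≤n)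
    (subst (inside es ⁅ v ⁆ᵥ <_) (sumOverᵥ-⁅⁆ v c)
      (≤∧≢⇒< (hall ⁅ v ⁆ᵥ) (λ t → tight⇒∌v t (∈⁅⁆ᵥ v))))

  -- A set containing v that the lowered capacities cannot accommodate would be tight,
  -- hence contained in maxTight, which misses v.
  Hall-lower : Hall es (lower c v)
  Hall-lower S with v ∈ᵥ? S | sumOverᵥ-lower c v outside-maxTight⇒positive S
  ... | no  _   | eq = subst (inside es S ≤_) (trans (sym eq) (+-identityʳ _)) (hall S)
  ... | yes v∈S | eq with inside es S ≤? sumOverᵥ S (lower c v)
  ...   | yes fits = fits
  ...   | no ¬fits = contradiction v∈S (tight⇒∌v tight)
    where
    open ≤-Reasoning
    tight : Tight es c S
    tight = ≤-antisym (hall S) (begin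
      sumOverᵥ S c                  ≡⟨ eq ⟨
      sumOverᵥ S (lower c v) + 1    ≡⟨ +-comm _ 1 ⟩
      suc (sumOverᵥ S (lower c v))  ≤⟨ ≰⇒> ¬fits ⟩
      inside es S                   ∎)

-- The head is Maybe-valued only so that no default vertex is needed (Vertex m n may be
-- empty); on the edges of es it is always `just`.
record Orientation (es : List (VertexSet m n)) (c : Vertex m n → ℕ) : Set where
  field
    head      : VertexSet m n → Maybe (Vertex m n)
    head∈     : ∀ {e} → e ∈ es → MaybeAny.Any (_∈ᵤᵥ e) (head e)
    indegree≤ : ∀ w → indegree head es w ≤ c w

_≟ₛ_ : DecidableEquality (VertexSet m n)
_≟ₛ_ = ProductP.≡-dec (VecP.≡-dec BoolP._≟_) (VecP.≡-dec BoolP._≟_)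

extend : ∀ {e : VertexSet m n} {es c v} → ¬ e ∈ es → v ∈ᵤᵥ e → 1 ≤ c v →
         Orientation es (lower c v) → Orientation (e ∷ es) c
extend {e = e} {es} {c} {v} e∉es v∈e c≥1 O = record
  { head = head′ ; head∈ = head′∈ ; indegree≤ = indegree′≤ }
  where
  open Orientation O
  head′ : VertexSet _ _ → Maybe (Vertex _ _)
  head′ e′ = if does (e′ ≟ₛ e) then just v else head e′

  head′-e : head′ e ≡ just v
  head′-e = cong (if_then just v else head e) (dec-true (e ≟ₛ e) refl)

  head′-es : ∀ {e′} → e′ ∈ es → head′ e′ ≡ head e′
  head′-es {e′} e′∈es =
    cong (if_then just v else head e′) (dec-false (e′ ≟ₛ e) λ { refl → e∉es e′∈es })

  head′∈ : ∀ {e′} → e′ ∈ e ∷ es → MaybeAny.Any (_∈ᵤᵥ e′) (head′ e′)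
  head′∈ (here refl)   = subst (MaybeAny.Any (_∈ᵤᵥ e)) (sym head′-e) (just v∈e)
  head′∈ (there e′∈es) = subst (MaybeAny.Any (_∈ᵤᵥ _)) (sym (head′-es e′∈es)) (head∈ e′∈es)

  indegree′≤ : ∀ w → indegree head′ (e ∷ es) w ≤ c w
  indegree′≤ w = begin
    𝟙 (does (MaybeP.≡-dec _≟ᵥ_ (head′ e) (just w))) + indegree head′ es w
      ≡⟨ cong₂ (λ h d → 𝟙 (does (MaybeP.≡-dec _≟ᵥ_ h (just w))) + d) head′-e
               (count-cong es λ e′∈es → cong (λ h → does (MaybeP.≡-dec _≟ᵥ_ h (just w))) (head′-es e′∈es)) ⟩
    𝟙 (does (v ≟ᵥ w)) + indegree head es w  ≤⟨ +-monoʳ-≤ _ (indegree≤ w) ⟩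
    𝟙 (does (v ≟ᵥ w)) + lower c v w         ≡⟨ +-comm _ (lower c v w) ⟩
    lower c v w + 𝟙 (does (v ≟ᵥ w))         ≡⟨ lower-+ c v c≥1 w ⟩
    c w                                     ∎
    where open ≤-Reasoning

orientation : ∀ (es : List (VertexSet m n)) c → Unique es → Hall es c → Orientation es c
orientation []       c _ _ = record { head = λ _ → nothing ; head∈ = λ () ; indegree≤ = λ _ → z≤n }
orientation (e ∷ es) c (e≢es ∷ unique) hall′ =
  let v , v∈e , v∉T = ⊈ᵥ⇒∃∉ (⊈maxTight es c hall e hall′)
  in extend e∉es v∈e (outside-maxTight⇒positive es c hall v∉T)
            (orientation es (lower c v) unique (Hall-lower es c hall v∉T))
  where
  hall : Hall es c
  hall = Hall-∷⁻ e es c hall′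
  e∉es : ¬ e ∈ es
  e∉es e∈es = All.lookup e≢es e∈es refl

hkPairs-unique : ∀ m n h k → Unique (hkPairs m n h k)
hkPairs-unique m n h k =
  UniqueP.filter⁺ _ (UniqueP.cartesianProduct⁺ (allSubsets-unique m) (allSubsets-unique n))

∈-hkPairs⁺ : ∀ {h k} {U : Subset m} {V : Subset n} → ∣ U ∣ ≡ h → ∣ V ∣ ≡ k →
             (U , V) ∈ hkPairs m n h k
∈-hkPairs⁺ {U = U} {V} |U|≡h |V|≡k = ∈-filter⁺ _ (∈-allVertexSets (U , V)) (|U|≡h , |V|≡k)

∈-hkPairs⁻ : ∀ {h k} {e : VertexSet m n} → e ∈ hkPairs m n h k →
             ∣ proj₁ e ∣ ≡ h × ∣ proj₂ e ∣ ≡ k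
∈-hkPairs⁻ e∈ = proj₂ (∈-filter⁻ _ {xs = allVertexSets} e∈)

inside-hkPairs : ∀ h k (X : Subset m) (Y : Subset n) →
                 inside (hkPairs m n h k) (X , Y) ≡ (∣ X ∣ C h) * (∣ Y ∣ C k)
inside-hkPairs {m} {n} h k X Y = begin
  inside (hkPairs m n h k) (X , Y)
    ≡⟨ count-filter (λ e → (∣ proj₁ e ∣ ≟ h) ×-dec (∣ proj₂ e ∣ ≟ k)) (λ e → does (e ⊆ᵥ? (X , Y)))
                    (allVertexSets {m} {n}) ⟩
  count (λ (U , V) → (sized h U ∧ sized k V) ∧ (does (U ⊆? X) ∧ does (V ⊆? Y))) allVertexSets
    ≡⟨ count-cong (allVertexSets {m} {n}) (λ {(U , V)} _ → ∧-interchange (sized h U) _ _ _) ⟩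
  count (λ (U , V) → sized⊆ h X U ∧ sized⊆ k Y V) allVertexSets
    ≡⟨ count-cartesianProduct (sized⊆ h X) (sized⊆ k Y) (allSubsets m) (allSubsets n) ⟩
  count (sized⊆ h X) (allSubsets m) * count (sized⊆ k Y) (allSubsets n)
    ≡⟨ cong₂ _*_ (count-⊆-allSubsets X h) (count-⊆-allSubsets Y k) ⟩
  (∣ X ∣ C h) * (∣ Y ∣ C k) ∎
  where
  open ≡-Reasoning
  sized : ∀ {r} → ℕ → Subset r → Bool
  sized s U = does (∣ U ∣ ≟ s)
  sized⊆ : ∀ {r} → ℕ → Subset r → Subset r → Bool
  sized⊆ s Z U = sized s U ∧ does (U ⊆? Z)

inside-hkPairs-⊤ : ∀ m n h k → inside (hkPairs m n h k) ⊤ᵥ ≡ (m C h) * (n C k)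
inside-hkPairs-⊤ m n h k =
  trans (inside-hkPairs {m} {n} h k ⊤ ⊤) (cong₂ (λ a b → (a C h) * (b C k)) (∣⊤∣≡n m) (∣⊤∣≡n n))

length-hkPairs : ∀ m n h k → length (hkPairs m n h k) ≡ (m C h) * (n C k)
length-hkPairs m n h k =
  trans (sym (count-all (_⊆ᵥ? ⊤ᵥ) (hkPairs m n h k) (λ _ → ⊆⊤ , ⊆⊤))) (inside-hkPairs-⊤ m n h k)

-- Prefix sums of sorted and of permuted lists

NonDecreasing-tail : ∀ {a} {A : Vec ℕ k} → NonDecreasing (a ∷ A) → NonDecreasing A
NonDecreasing-tail nd i j i≤j = nd (suc i) (suc j) (s≤s i≤j)

NonDecreasing-head : ∀ {a} {A : Vec ℕ k} → NonDecreasing (a ∷ A) → ∀ j → a ≤ lookup A j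
NonDecreasing-head nd j = nd zero (suc j) z≤n

prefixSum-∷-≤ : ∀ {a} (A : Vec ℕ k) → NonDecreasing A → (∀ j → a ≤ lookup A j) →
                ∀ p → p ≤ k → prefixSum (a ∷ A) p ≤ prefixSum A p
prefixSum-∷-≤         A       nd a≤A zero    p≤k       = z≤n
prefixSum-∷-≤ {a = a} (b ∷ A) nd a≤A (suc p) (s≤s p≤k) = begin
  a + prefixSum (b ∷ A) p  ≤⟨ +-monoʳ-≤ a (prefixSum-∷-≤ A (NonDecreasing-tail nd) (NonDecreasing-head nd) p p≤k) ⟩
  a + prefixSum A p        ≤⟨ +-monoˡ-≤ (prefixSum A p) (a≤A zero) ⟩
  b + prefixSum A p        ∎
  where open ≤-Reasoning

prefixSum≤sumOver : ∀ (A : Vec ℕ k) → NonDecreasing A → (X : Subset k) →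
                    prefixSum A ∣ X ∣ ≤ sumOver X (lookup A)
prefixSum≤sumOver []      nd []          = z≤n
prefixSum≤sumOver (a ∷ A) nd (true  ∷ X) = +-monoʳ-≤ a (prefixSum≤sumOver A (NonDecreasing-tail nd) X)
prefixSum≤sumOver (a ∷ A) nd (false ∷ X) = ≤-trans
  (prefixSum-∷-≤ A (NonDecreasing-tail nd) (NonDecreasing-head nd) ∣ X ∣ (∣p∣≤n X))
  (prefixSum≤sumOver A (NonDecreasing-tail nd) X)

prefixSum-all : ∀ (A : Vec ℕ k) → prefixSum A k ≡ sum (toList A)
prefixSum-all {k} A = cong sum (take-all k (toList A) (≤-reflexive (VecP.length-toList A)))

tabulate-lookup : ∀ (A : Vec B k) → tabulate (lookup A) ≡ toList A
tabulate-lookup []      = refl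
tabulate-lookup (a ∷ A) = cong (a ∷_) (tabulate-lookup A)

↭⇒sumOver-⊤ : ∀ {s : Fin k → ℕ} {A : Vec ℕ k} → tabulate s ↭ toList A →
              sumOver ⊤ s ≡ prefixSum A k
↭⇒sumOver-⊤ {s = s} {A} s↭A = trans (sumOver-⊤ s) (trans (sum-↭ s↭A) (sym (prefixSum-all A)))

select : List Bool → List ℕ → ℕ
select (b ∷ M) (x ∷ xs) = (if b then x else 0) + select M xs
select _       _        = 0

↭-mask : ∀ {xs ys} → xs ↭ ys → ∀ M → length M ≡ length ys →
         ∃ λ M′ → length M′ ≡ length xs × count id M′ ≡ count id M × select M′ xs ≡ select M ys
↭-mask ↭.refl M |M| = M , |M| , refl , refl
↭-mask (↭.prep x xs↭ys) (b ∷ M) |M| with ↭-mask xs↭ys M (suc-injective |M|)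
... | M′ , |M′| , #M′ , ΣM′ =
  b ∷ M′ , cong suc |M′| , cong (𝟙 b +_) #M′ , cong ((if b then x else 0) +_) ΣM′
↭-mask (↭.swap x y xs↭ys) (b ∷ b′ ∷ M) |M| with ↭-mask xs↭ys M (suc-injective (suc-injective |M|))
... | M′ , |M′| , #M′ , ΣM′ = b′ ∷ b ∷ M′ , cong (2 +_) |M′| ,
      trans (x∙yz≈y∙xz (𝟙 b′) (𝟙 b) _) (cong (λ r → 𝟙 b + (𝟙 b′ + r)) #M′) ,
      trans (x∙yz≈y∙xz (if b′ then x else 0) (if b then y else 0) _)
            (cong (λ r → (if b then y else 0) + ((if b′ then x else 0) + r)) ΣM′)
↭-mask (↭.trans xs↭ys ys↭zs) M |M| with ↭-mask ys↭zs M |M|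
... | M₁ , |M₁| , #M₁ , ΣM₁ with ↭-mask xs↭ys M₁ |M₁|
... | M′ , |M′| , #M′ , ΣM′ = M′ , |M′| , trans #M′ #M₁ , trans ΣM′ ΣM₁

count-toList : ∀ (X : Subset k) → count id (toList X) ≡ ∣ X ∣
count-toList []          = refl
count-toList (true  ∷ X) = cong suc (count-toList X)
count-toList (false ∷ X) = count-toList X

select-toList : ∀ (X : Subset k) f → select (toList X) (tabulate f) ≡ sumOver X f
select-toList []          f = refl
select-toList (true  ∷ X) f = cong (f zero +_) (select-toList X (f ∘ suc))
select-toList (false ∷ X) f = select-toList X (f ∘ suc)

prefixSet : ∀ p → p ≤ k → Subset k
prefixSet zero    _         = ⊥
prefixSet (suc p) (s≤s p≤k) = true ∷ prefixSet p p≤k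

∣prefixSet∣ : ∀ p (p≤k : p ≤ k) → ∣ prefixSet p p≤k ∣ ≡ p
∣prefixSet∣ {k} zero _         = ∣⊥∣≡0 k
∣prefixSet∣ (suc p) (s≤s p≤k) = cong suc (∣prefixSet∣ p p≤k)

sumOver-prefixSet : ∀ p (p≤k : p ≤ k) (A : Vec ℕ k) →
                    sumOver (prefixSet p p≤k) (lookup A) ≡ prefixSum A p
sumOver-prefixSet zero    _         A       = sumOver-⊥ (lookup A)
sumOver-prefixSet (suc p) (s≤s p≤k) (a ∷ A) = cong (a +_) (sumOver-prefixSet p p≤k A)

fromMask : ∀ M → length M ≡ k → Σ (Subset k) λ X → toList X ≡ M
fromMask M refl = fromList M , VecP.toList∘fromList M

↭⇒sumOver : ∀ {s : Fin k → ℕ} {A : Vec ℕ k} → tabulate s ↭ toList A →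
            ∀ P → Σ (Subset k) λ X → ∣ X ∣ ≡ ∣ P ∣ × sumOver X s ≡ sumOver P (lookup A)
↭⇒sumOver {s = s} {A} s↭A P
  with ↭-mask s↭A (toList P) (trans (VecP.length-toList P) (sym (VecP.length-toList A)))
... | M′ , |M′| , #M′ , ΣM′ with fromMask M′ (trans |M′| (length-tabulate s))
... | X , refl = X , trans (sym (count-toList X)) (trans #M′ (count-toList P)) , (begin
  sumOver X s                              ≡⟨ select-toList X s ⟨
  select (toList X) (tabulate s)           ≡⟨ ΣM′ ⟩
  select (toList P) (toList A)             ≡⟨ cong (select (toList P)) (tabulate-lookup A) ⟨
  select (toList P) (tabulate (lookup A))  ≡⟨ select-toList P (lookup A) ⟩
  sumOver P (lookup A)                     ∎)
  where open ≡-Reasoning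

↭⇒prefixSum : ∀ {s : Fin k → ℕ} {A : Vec ℕ k} → tabulate s ↭ toList A →
              ∀ p → p ≤ k → Σ (Subset k) λ X → ∣ X ∣ ≡ p × sumOver X s ≡ prefixSum A p
↭⇒prefixSum {A = A} s↭A p p≤k = Product.map₂
  (Product.map (λ |X| → trans |X| (∣prefixSet∣ p p≤k))
               (λ ΣX → trans ΣX (sumOver-prefixSet p p≤k A)))
  (↭⇒sumOver s↭A (prefixSet p p≤k))

verticesBut : VertexSet m n → Vertex m n → List (Vertex m n)
verticesBut S v = filter (λ w → ¬? (w ≟ᵥ v)) (vertices S)

∈-verticesBut⁻ : ∀ {S : VertexSet m n} {v w} → w ∈ verticesBut S v → w ∈ vertices S × w ≢ v
∈-verticesBut⁻ {S = S} {v} = ∈-filter⁻ (λ w → ¬? (w ≟ᵥ v)) {xs = vertices S}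

arcEndingAt : VertexSet m n → Vertex m n → List (Vertex m n)
arcEndingAt S v = verticesBut S v ++ [ v ]

last-arcEndingAt : ∀ (S : VertexSet m n) v → last (arcEndingAt S v) ≡ just v
last-arcEndingAt S v = last-∷ʳ (verticesBut S v) v

module _ {S : VertexSet m n} {v : Vertex m n} (v∈S : v ∈ᵤᵥ S) where

  length-arcEndingAt : length (arcEndingAt S v) ≡ ∣ proj₁ S ∣ + ∣ proj₂ S ∣
  length-arcEndingAt = begin
    length (verticesBut S v ++ [ v ])  ≡⟨ length-++ (verticesBut S v) ⟩
    length (verticesBut S v) + 1       ≡⟨ +-comm _ 1 ⟩
    suc (length (verticesBut S v))     ≡⟨ length-filter-≢ _≟ᵥ_ (vertices-unique S) (∈-vertices⁺ v∈S) ⟩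
    length (vertices S)                ≡⟨ length-vertices S ⟩
    ∣ proj₁ S ∣ + ∣ proj₂ S ∣           ∎
    where open ≡-Reasoning

  arcEndingAt-unique : Unique (arcEndingAt S v)
  arcEndingAt-unique = UniqueP.++⁺ (UniqueP.filter⁺ (λ w → ¬? (w ≟ᵥ v)) (vertices-unique S)) ([] ∷ [])
    λ { (v∈ , here refl) → proj₂ (∈-verticesBut⁻ {S = S} v∈) refl }

  arcEndingAt-⊆ : All (_∈ᵤᵥ S) (arcEndingAt S v)
  arcEndingAt-⊆ = AllP.++⁺ (All.tabulate λ w∈ → ∈-vertices⁻ (proj₁ (∈-verticesBut⁻ {S = S} w∈))) (v∈S ∷ [])

-- Necessity

module Necessity {m n h k : ℕ} (h+k>0 : 0 < h + k) (T : BipartiteHypertournament m n h k) where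
  open BipartiteHypertournament T

  pairs : List (VertexSet m n)
  pairs = hkPairs m n h k

  lastVertex : VertexSet m n → Maybe (Vertex m n)
  lastVertex (U , V) = last (arc U V)

  last∈ : ∀ {e S} → e ∈ pairs → e ⊆ᵥ S → MaybeAny.Any (_∈ᵤᵥ S) (lastVertex e)
  last∈ {U , V} e∈ e⊆S with ∈-hkPairs⁻ e∈
  ... | |U|≡h , |V|≡k with arc U V | arc-len U V |U|≡h |V|≡k | arc-elems U V |U|≡h |V|≡k
  ...   | []    | len | _    = contradiction len (<⇒≢ h+k>0)
  ...   | _ ∷ _ | _   | ⊆U∪V = MaybeAny.map (∈-⊆ᵥ e⊆S) (All⇒Any-last ⊆U∪V)

  losingScore≗indegree : losingScore ≗ indegree lastVertex pairs
  losingScore≗indegree w = length-filter≡count _ pairs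

  sumOverᵥ-losingScore : ∀ S → sumOverᵥ S losingScore ≡
                               count (λ e → does (MaybeAny.dec (_∈ᵥ? S) (lastVertex e))) pairs
  sumOverᵥ-losingScore S = trans (sumOverᵥ-cong S losingScore≗indegree) (sumOverᵥ-indegree S lastVertex pairs)

  inside≤losingScores : ∀ S → inside pairs S ≤ sumOverᵥ S losingScore
  inside≤losingScores S = ≤-trans (count-mono (_⊆ᵥ? S) (MaybeAny.dec (_∈ᵥ? S) ∘ lastVertex) pairs last∈)
                                  (≤-reflexive (sym (sumOverᵥ-losingScore S)))

  losingScores-total : sumOverᵥ ⊤ᵥ losingScore ≡ (m C h) * (n C k)
  losingScores-total = ≤-antisym
    (≤-trans (≤-reflexive (sumOverᵥ-losingScore ⊤ᵥ))
             (≤-trans (count≤length _ pairs) (≤-reflexive (length-hkPairs m n h k))))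
    (≤-trans (≤-reflexive (sym (inside-hkPairs-⊤ m n h k))) (inside≤losingScores ⊤ᵥ))

  prefixSums-bound : ∀ {A : Vec ℕ m} {B : Vec ℕ n} → AreLosingScoreLists T A B →
                     ∀ p q → p ≤ m → q ≤ n → (p C h) * (q C k) ≤ prefixSum A p + prefixSum B q
  prefixSums-bound (U↭A , V↭B) p q p≤m q≤n
    with ↭⇒prefixSum U↭A p p≤m | ↭⇒prefixSum V↭B q q≤n
  ... | X , |X|≡p , ΣX | Y , |Y|≡q , ΣY = begin
    (p C h) * (q C k)                    ≡⟨ cong₂ (λ a b → (a C h) * (b C k)) |X|≡p |Y|≡q ⟨
    (∣ X ∣ C h) * (∣ Y ∣ C k)            ≡⟨ inside-hkPairs h k X Y ⟨
    inside pairs (X , Y)                 ≤⟨ inside≤losingScores (X , Y) ⟩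
    sumOverᵥ (X , Y) losingScore         ≡⟨ cong₂ _+_ ΣX ΣY ⟩
    prefixSum _ p + prefixSum _ q        ∎
    where open ≤-Reasoning

  prefixSums-total : ∀ {A : Vec ℕ m} {B : Vec ℕ n} → AreLosingScoreLists T A B →
                     prefixSum A m + prefixSum B n ≡ (m C h) * (n C k)
  prefixSums-total (U↭A , V↭B) =
    trans (sym (cong₂ _+_ (↭⇒sumOver-⊤ U↭A) (↭⇒sumOver-⊤ V↭B))) losingScores-total

-- Sufficiency

module Sufficiency {m n h k : ℕ} (h>0 : 0 < h) (k>0 : 0 < k)
  (A : Vec ℕ m) (B : Vec ℕ n) (A↑ : NonDecreasing A) (B↑ : NonDecreasing B)
  (bound : (p q : ℕ) → 1 ≤ p → p ≤ m → 1 ≤ q → q ≤ n →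
           prefixSum A p + prefixSum B q ≥ (p C h) * (q C k))
  (total : prefixSum A m + prefixSum B n ≡ (m C h) * (n C k)) where

  pairs : List (VertexSet m n)
  pairs = hkPairs m n h k

  scores : Vertex m n → ℕ
  scores (inj₁ i) = lookup A i
  scores (inj₂ j) = lookup B j

  prefixSums-bound : ∀ p q → p ≤ m → q ≤ n → (p C h) * (q C k) ≤ prefixSum A p + prefixSum B q
  prefixSums-bound zero    q       _   _   =
    ≤-trans (≤-reflexive (cong (_* (q C k)) (k>n⇒nCk≡0 h>0))) z≤n
  prefixSums-bound (suc p) zero    _   _   =
    ≤-trans (≤-reflexive (trans (cong ((suc p C h) *_) (k>n⇒nCk≡0 k>0)) (*-zeroʳ (suc p C h)))) z≤n
  prefixSums-bound (suc p) (suc q) p≤m q≤n = bound (suc p) (suc q) (s≤s z≤n) p≤m (s≤s z≤n) q≤n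

  hall : Hall pairs scores
  hall (X , Y) = begin
    inside pairs (X , Y)                   ≡⟨ inside-hkPairs h k X Y ⟩
    (∣ X ∣ C h) * (∣ Y ∣ C k)              ≤⟨ prefixSums-bound ∣ X ∣ ∣ Y ∣ (∣p∣≤n X) (∣p∣≤n Y) ⟩
    prefixSum A ∣ X ∣ + prefixSum B ∣ Y ∣  ≤⟨ +-mono-≤ (prefixSum≤sumOver A A↑ X) (prefixSum≤sumOver B B↑ Y) ⟩
    sumOverᵥ (X , Y) scores                ∎
    where open ≤-Reasoning

  open Orientation (orientation pairs scores (hkPairs-unique m n h k) hall)

  head-just : ∀ {e} → e ∈ pairs → ∃ λ v → head e ≡ just v × v ∈ᵤᵥ e
  head-just {e} e∈ with head e | head∈ e∈
  ... | just v | just v∈e = v , refl , v∈e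

  indegree≗scores : indegree head pairs ≗ scores
  indegree≗scores = sumOverᵥ-⊤-≗ indegree≤ (begin
    sumOverᵥ ⊤ᵥ (indegree head pairs)
      ≡⟨ sumOverᵥ-indegree ⊤ᵥ head pairs ⟩
    count (λ e → does (MaybeAny.dec (_∈ᵥ? ⊤ᵥ) (head e))) pairs
      ≡⟨ count-all (MaybeAny.dec (_∈ᵥ? ⊤ᵥ) ∘ head) pairs (MaybeAny.map (λ {v} _ → ∈⊤ᵥ v) ∘ head∈) ⟩
    length pairs                         ≡⟨ length-hkPairs m n h k ⟩
    (m C h) * (n C k)                    ≡⟨ total ⟨
    prefixSum A m + prefixSum B n        ≡⟨ cong₂ _+_ (↭⇒sumOver-⊤ (↭.↭-reflexive (tabulate-lookup A)))
                                                      (↭⇒sumOver-⊤ (↭.↭-reflexive (tabulate-lookup B))) ⟨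
    sumOverᵥ ⊤ᵥ scores                   ∎)
    where open ≡-Reasoning

  arcOf : VertexSet m n → List (Vertex m n)
  arcOf e = maybe′ (arcEndingAt e) [] (head e)

  arcOf-hkPair : ∀ {U V} → ∣ U ∣ ≡ h → ∣ V ∣ ≡ k →
                 ∃ λ v → v ∈ᵤᵥ (U , V) × arcOf (U , V) ≡ arcEndingAt (U , V) v
  arcOf-hkPair {U} {V} |U|≡h |V|≡k with head-just (∈-hkPairs⁺ |U|≡h |V|≡k)
  ... | v , eq , v∈ = v , v∈ , cong (maybe′ (arcEndingAt (U , V)) []) eq

  tournament : BipartiteHypertournament m n h k
  tournament = record
    { arc       = λ U V → arcOf (U , V)
    ; arc-len   = λ U V |U|≡h |V|≡k → let v , v∈ , eq = arcOf-hkPair |U|≡h |V|≡k in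
        trans (cong length eq) (trans (length-arcEndingAt v∈) (cong₂ _+_ |U|≡h |V|≡k))
    ; arc-dist  = λ U V |U|≡h |V|≡k → let v , v∈ , eq = arcOf-hkPair |U|≡h |V|≡k in
        subst Unique (sym eq) (arcEndingAt-unique v∈)
    ; arc-elems = λ U V |U|≡h |V|≡k → let v , v∈ , eq = arcOf-hkPair |U|≡h |V|≡k in
        subst (All (_∈ᵤᵥ (U , V))) (sym eq) (arcEndingAt-⊆ v∈)
    }

  open BipartiteHypertournament tournament using (losingScore)

  last-arcOf : ∀ {e} → e ∈ pairs → last (arcOf e) ≡ head e
  last-arcOf {e} e∈ with head-just e∈
  ... | v , eq , _ rewrite eq = last-arcEndingAt e v

  losingScore≗scores : losingScore ≗ scores
  losingScore≗scores w = begin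
    losingScore w                   ≡⟨ length-filter≡count _ pairs ⟩
    indegree (last ∘ arcOf) pairs w ≡⟨ count-cong pairs (cong (λ l → does (MaybeP.≡-dec _≟ᵥ_ l (just w))) ∘ last-arcOf) ⟩
    indegree head pairs w           ≡⟨ indegree≗scores w ⟩
    scores w                        ∎
    where open ≡-Reasoning

  losingScoreLists : AreLosingScoreLists tournament A B
  losingScoreLists =
    ↭.↭-reflexive (trans (tabulate-cong (losingScore≗scores ∘ inj₁)) (tabulate-lookup A)) ,
    ↭.↭-reflexive (trans (tabulate-cong (losingScore≗scores ∘ inj₂)) (tabulate-lookup B))

theorem2p1 : (m n h k : ℕ) → 1 < h → h ≤ m → 1 < k → k ≤ n →
    (A : Vec ℕ m) (B : Vec ℕ n) → NonDecreasing A → NonDecreasing B →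
    (Σ (BipartiteHypertournament m n h k) (λ T → AreLosingScoreLists T A B))
    ⇔ (((p q : ℕ) → 1 ≤ p → p ≤ m → 1 ≤ q → q ≤ n →
          prefixSum A p + prefixSum B q ≥ (p C h) * (q C k))
       × (prefixSum A m + prefixSum B n ≡ (m C h) * (n C k)))
theorem2p1 m n h k 1<h _ 1<k _ A B A↑ B↑ = mk⇔
  (λ (T , lists) → let open Necessity h+k>0 T in
    (λ p q _ p≤m _ q≤n → prefixSums-bound lists p q p≤m q≤n) , prefixSums-total lists)
  (λ (bound , total) → let open Sufficiency h>0 k>0 A B A↑ B↑ bound total in
    tournament , losingScoreLists)
  where
  h>0 : 0 < h
  h>0 = <-trans (s≤s z≤n) 1<h
  k>0 : 0 < k
  k>0 = <-trans (s≤s z≤n) 1<k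
  h+k>0 : 0 < h + k
  h+k>0 = ≤-trans h>0 (m≤m+n h k)
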